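{- Every excisive and functorial clustering scheme is refined by a representable clustering scheme.
   Context: A hypergraph is a triple $G=(V,E,\epsilon)$, where $V$ is a finite vertex set, $E$ is a finite edge set disjoint from $V$, and $\epsilon:E\to2^V$ gives edge vertex sets. Distinct edges may have the same vertex set. A morphism $H\to G$ is an injective map $f:V(H)\to V(G)$ such that for every edge $e$ of $H$ there is an edge $e'$ of $G$ with $f(\epsilon_H(e))=\epsilon_G(e')$; $\hom(H,G)$ is the set of morphisms. For $p\subseteq V$, the restriction $G|_p$ has vertex set $p$ and those edges $e$ with $\epsilon(e)\subseteq p$. $\mathcal P$ is the category with objects $(V,P)$, where $V$ is finite and $P\subseteq 2^V$ (parts need not be disjoint or covering). Its morphisms $(V,P)\to(W,Q)$ are functions $f:V\to W$ such that each $p\in P$ has some $q\in Q$ with $f(p)\subseteq q$. A clustering scheme $\mathfrak c$ assigns to each hypergraph $G$ an object $(V(G),P)$ of $\mathcal P$. It is functorial if every morphism $f:G\to H$ is also a morphism $\mathfrak c(G)\to\mathfrak c(H)$ in $\mathcal P$. It is excisive if for every $G$ and every part $p$ of $\mathfrak c(G)$, $p$ is a part of $\mathfrak c(G|_p)$. $\mathfrak c_1$ refines $\mathfrak c_2$ if for every $G$: every part of $\mathfrak c_1(G)$ is contained in some part of $\mathfrak c_2(G)$, and every part of $\mathfrak c_2(G)$ is a part of $\mathfrak c_1(G)$. For a set $\mathfrak R$ of hypergraphs, $\Phi_{\mathfrak R}(G)$ has vertex set $V(G)$ and edge set $\bigcup_{R\in\mathfrak R}\hom(R,G)$ (disjoint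 union), where the edge $\omega\in\hom(R,G)$ has vertex set $\omega(V(R))$. For $k\in\mathbb N\cup\{\infty\}$, $k\ge1$, the $k$-line graph $\Lambda_k(G)$ is the simple graph with vertex set $\{\epsilon(e):e\in E\}$ in which distinct $u,v$ are adjacent iff $|u\cap v|\ge k$ (no edges if $k=\infty$). $\Pi_k(G)=(V(G),P)$, where $P$ consists of the sets $\bigcup_{x\in C}x$ for $C$ ranging over the vertex sets of connected components (including singletons) of $\Lambda_k(G)$. A representable clustering scheme is one of the form $\Pi_k\circ\Phi_{\mathfrak R}$ for some set $\mathfrak R$ of hypergraphs and some such $k$. -}

module Defs where

open import Data.Bool using (Bool; true; false; T; not; _∨_)
open import Data.Bool.Properties using (T-irrelevant)
open import Data.Empty using (⊥; ⊥-elim)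
open import Data.Unit using (⊤; tt)
open import Level using (Lift)
open import Data.Nat using (ℕ; _≤_)
open import Data.Fin using (Fin)
open import Data.List using (List; []; _∷_)
open import Data.Bool using (_∧_)
open import Data.List.Membership.Propositional using (_∈_)
open import Data.List.Relation.Unary.Any using (here; there)
open import Data.Product using (Σ; Σ-syntax; ∃; _×_; _,_; proj₁; proj₂)
open import Function.Definitions using (Injective)
open import Relation.Binary.Definitions using (DecidableEquality)
open import Relation.Binary.PropositionalEquality using (_≡_; refl; cong)
open import Relation.Nullary using (yes; no; ¬_)
open import Relation.Nullary.Decidable using (T?)

record Finite (A : Set) : Set where
  field
    _≟_      : DecidableEquality A
    enum     : List A
    complete : ∀ a → a ∈ enum

open Finite public

Subset : Set → Set
Subset V = V → Bool

_∈ₛ_ : {V : Set} → V → Subset V → Set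
v ∈ₛ p = T (p v)

_⊆ₛ_ : {V : Set} → Subset V → Subset V → Set
p ⊆ₛ q = ∀ v → v ∈ₛ p → v ∈ₛ q

_≐_ : {V : Set} → Subset V → Subset V → Set
p ≐ q = ∀ v → p v ≡ q v

full : {V : Set} → Subset V
full _ = true

ImageSub : {V W : Set} → (V → W) → Subset V → Subset W → Set
ImageSub f p q = ∀ v → v ∈ₛ p → f v ∈ₛ q

IsImage : {V W : Set} → (V → W) → Subset V → Subset W → Set
IsImage f p q = ImageSub f p q × (∀ w → w ∈ₛ q → Σ _ λ v → v ∈ₛ p × f v ≡ w)

allB : {A : Set} → (A → Bool) → List A → Bool
allB f [] = true
allB f (a ∷ as) = f a ∧ allB f as

subset? : {V : Set} → Finite V → Subset V → Subset V → Bool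
subset? fin p q = allB (λ v → not (p v) ∨ q v) (enum fin)

module _ {A : Set} (q : A → Bool) where

  sub-enum : List A → List (Σ A (λ a → T (q a)))
  sub-enum [] = []
  sub-enum (a ∷ as) with T? (q a)
  ... | yes t = (a , t) ∷ sub-enum as
  ... | no _  = sub-enum as

  sub-complete : ∀ {a} (t : T (q a)) as → a ∈ as → (a , t) ∈ sub-enum as
  sub-complete {a} t (x ∷ as) (here refl) with T? (q a)
  ... | yes t' = here (cong (a ,_) (T-irrelevant t t'))
  ... | no ¬t  = ⊥-elim (¬t t)
  sub-complete t (x ∷ as) (there m) with T? (q x)
  ... | yes _ = there (sub-complete t as m)
  ... | no _  = sub-complete t as m

  sub-finite : Finite A → Finite (Σ A (λ a → T (q a)))
  _≟_ (sub-finite fin) (a , t) (b , u) with _≟_ fin a b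
  ... | yes refl = yes (cong (a ,_) (T-irrelevant t u))
  ... | no a≢b   = no (λ eq → a≢b (cong proj₁ eq))
  enum (sub-finite fin) = sub-enum (enum fin)
  complete (sub-finite fin) (a , t) = sub-complete t (enum fin) (complete fin a)

record Hypergraph : Set₁ where
  field
    V    : Set
    E    : Set
    ε    : E → Subset V
    finV : Finite V
    finE : Finite E

open Hypergraph public

IsMorphism : (H G : Hypergraph) → (V H → V G) → Set
IsMorphism H G f =
  Injective _≡_ _≡_ f × (∀ (e : E H) → Σ (E G) λ e' → IsImage f (ε H e) (ε G e'))

Hom : Hypergraph → Hypergraph → Set
Hom H G = Σ (V H → V G) (IsMorphism H G)

_∣_ : (G : Hypergraph) → Subset (V G) → Hypergraph
V (G ∣ p) = Σ (V G) (λ v → T (p v))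
E (G ∣ p) = Σ (E G) (λ e → T (subset? (finV G) (ε G e) p))
ε (G ∣ p) (e , _) (v , _) = ε G e v
finV (G ∣ p) = sub-finite p (finV G)
finE (G ∣ p) = sub-finite (λ e → subset? (finV G) (ε G e) p) (finE G)

-- The category 𝒫 : objects (V, P) with P ⊆ 2^V, given by a predicate
-- on subsets (a subset p is a part when it equals some q with P q).

Parts : Set → Set₂
Parts V = Subset V → Set₁

IsPart : {V : Set} → Parts V → Subset V → Set₁
IsPart P p = Σ (Subset _) λ q → P q × q ≐ p

𝒫-Morphism : {V W : Set} → Parts V → Parts W → (V → W) → Set₁
𝒫-Morphism P Q f = ∀ p → IsPart P p → Σ (Subset _) λ q → IsPart Q q × ImageSub f p q

ClusteringScheme : Set₂
ClusteringScheme = (G : Hypergraph) → Parts (V G)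

Functorial : ClusteringScheme → Set₁
Functorial c = ∀ (G H : Hypergraph) (f : Hom G H) → 𝒫-Morphism (c G) (c H) (proj₁ f)

Excisive : ClusteringScheme → Set₁
Excisive c = ∀ (G : Hypergraph) (p : Subset (V G)) → IsPart (c G) p → IsPart (c (G ∣ p)) full

Refines : ClusteringScheme → ClusteringScheme → Set₁
Refines c₁ c₂ = ∀ (G : Hypergraph) →
  (∀ p → IsPart (c₁ G) p → Σ (Subset (V G)) λ q → IsPart (c₂ G) q × p ⊆ₛ q)
  × (∀ p → IsPart (c₂ G) p → IsPart (c₁ G) p)

data ℕ∞ : Set where
  fin : ℕ → ℕ∞
  ∞   : ℕ∞

Positive : ℕ∞ → Set
Positive (fin k) = 1 ≤ k
Positive ∞       = ⊤

-- |u ∩ v| ≥ k  (there are k distinct elements in u ∩ v); never for ∞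
AtLeastCommon : {V : Set} → ℕ∞ → Subset V → Subset V → Set
AtLeastCommon {V} (fin k) u v =
  Σ (Fin k → V) λ g → Injective _≡_ _≡_ g × (∀ i → g i ∈ₛ u × g i ∈ₛ v)
AtLeastCommon ∞ u v = ⊥

-- Connectivity in the k-line graph Λ_k whose vertex set is the family S
-- of edge vertex sets (given as a predicate on subsets).
data Connected {V : Set} (k : ℕ∞) (S : Subset V → Set₁) :
     Subset V → Subset V → Set₁ where
  start : ∀ {u} → S u → Connected k S u u
  step  : ∀ {u v w} → Connected k S u v → S w → AtLeastCommon k v w →
          Connected k S u w

-- Π_k applied to a family S of edge vertex sets: the parts are the unions
-- of the connected components of Λ_k.
ΠFam : {V : Set} → ℕ∞ → (Subset V → Set₁) → Parts V
ΠFam k S q = Σ (Subset _) λ u → S u ×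
  (∀ x → (x ∈ₛ q → Σ (Subset _) λ w → Connected k S u w × x ∈ₛ w)
       × (∀ w → Connected k S u w → x ∈ₛ w → x ∈ₛ q))

Π : ℕ∞ → ClusteringScheme
Π k G = ΠFam k (λ s → Lift _ (Σ (E G) λ e → ε G e ≐ s))

-- the family of edge vertex sets of Φ_ℜ(G): ω(V(R)) for R ∈ ℜ, ω ∈ hom(R,G)
ΦEdgeSets : (Hypergraph → Set₁) → (G : Hypergraph) → Subset (V G) → Set₁
ΦEdgeSets ℜ G s = Σ Hypergraph λ R → ℜ R × Σ (Hom R G) λ ω → IsImage (proj₁ ω) full s

Representable : (Hypergraph → Set₁) → ℕ∞ → ClusteringScheme
Representable ℜ k G = ΠFam k (ΦEdgeSets ℜ G)

{-# OPTIONS --safe #-}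
module Submission where

open import Defs
open import Data.Bool using (Bool; true; T; not; _∨_)
open import Data.Bool.Properties using (T-irrelevant; T-∧)
open import Data.List using (List; _∷_)
open import Data.List.Membership.Propositional using (_∈_)
open import Data.List.Relation.Unary.Any using (here; there)
open import Data.Product using (Σ; _×_; _,_; proj₁; proj₂)
open import Data.Unit using (tt)
open import Function.Bundles using (Equivalence)
open import Relation.Binary.PropositionalEquality using (_≡_; refl; cong; subst; sym)

-- Take ℜ to be the hypergraphs that c clusters into a single part, and k = ∞,
-- so that Λ_∞ has no edges and the parts of Π_∞ ∘ Φ_ℜ (G) are exactly the
-- images of morphisms R → G with R ∈ ℜ. Functoriality pushes the part V(R)
-- of c(R) into a part of c(G), so every such image lies in a part of c(G);
-- conversely excision makes G|_p a member of ℜ for each part p of c(G), and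
-- the inclusion G|_p → G has image p.

⊆ₛ-trans : {V : Set} {p q r : Subset V} → p ⊆ₛ q → q ⊆ₛ r → p ⊆ₛ r
⊆ₛ-trans p⊆q q⊆r v v∈p = q⊆r v (p⊆q v v∈p)

allB-sound : {A : Set} (f : A → Bool) (as : List A) → T (allB f as) → ∀ a → a ∈ as → T (f a)
allB-sound f (b ∷ as) t a (here refl) = proj₁ (Equivalence.to T-∧ t)
allB-sound f (b ∷ as) t a (there a∈as) = allB-sound f as (proj₂ (Equivalence.to T-∧ t)) a a∈as

T-implication : (a b : Bool) → T (not a ∨ b) → T a → T b
T-implication true true _ _ = tt

subset?-sound : {V : Set} (finite : Finite V) (p q : Subset V) → T (subset? finite p q) → p ⊆ₛ q
subset?-sound finite p q t v =
  T-implication (p v) (q v) (allB-sound (λ v → not (p v) ∨ q v) (enum finite) t v (complete finite v))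

inclusion : (G : Hypergraph) (p : Subset (V G)) → Hom (G ∣ p) G
inclusion G p = proj₁ , proj₁-injective , edge-image
  where
  proj₁-injective : ∀ {a b : V (G ∣ p)} → proj₁ a ≡ proj₁ b → a ≡ b
  proj₁-injective {a , t} {.a , t′} refl = cong (a ,_) (T-irrelevant t t′)

  edge-image : ∀ (e : E (G ∣ p)) → Σ (E G) λ e′ → IsImage proj₁ (ε (G ∣ p) e) (ε G e′)
  edge-image (e , ε[e]⊆p) = e , (λ _ v∈e → v∈e) ,
    λ v v∈e → (v , subset?-sound (finV G) (ε G e) p ε[e]⊆p v v∈e) , v∈e , refl

inclusion-image : (G : Hypergraph) (p : Subset (V G)) → IsImage (proj₁ (inclusion G p)) full p
inclusion-image G p = (λ v _ → proj₂ v) , λ v v∈p → (v , v∈p) , tt , refl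

Connected-∞-⊆ : {V : Set} {S : Subset V → Set₁} {u w : Subset V} → Connected ∞ S u w → w ⊆ₛ u
Connected-∞-⊆ (start _) _ x∈w = x∈w
Connected-∞-⊆ (step _ _ ())

ΠFam-∞-member⇒part : {V : Set} {S : Subset V → Set₁} {u : Subset V} → S u → IsPart (ΠFam ∞ S) u
ΠFam-∞-member⇒part {u = u} Su =
  u , (u , Su , λ x → (λ x∈u → u , start Su , x∈u) , λ _ u~w x∈w → Connected-∞-⊆ u~w x x∈w) , λ _ → refl

ΠFam-∞-part⊆member : {V : Set} {S : Subset V → Set₁} {p : Subset V} →
  IsPart (ΠFam ∞ S) p → Σ (Subset V) λ u → S u × p ⊆ₛ u
ΠFam-∞-part⊆member (q , (u , Su , component) , q≐p) = u , Su , λ x x∈p →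
  let (w , u~w , x∈w) = proj₁ (component x) (subst T (sym (q≐p x)) x∈p)
  in Connected-∞-⊆ u~w x x∈w

Clustered : ClusteringScheme → Hypergraph → Set₁
Clustered c R = IsPart (c R) full

ΦEdgeSet⊆part : (c : ClusteringScheme) → Functorial c → (G : Hypergraph) {s : Subset (V G)} →
  ΦEdgeSets (Clustered c) G s → Σ (Subset (V G)) λ q → IsPart (c G) q × s ⊆ₛ q
ΦEdgeSet⊆part c functorial G (R , clustered , ω , image[ω]≡s) =
  let (q , q-part , image[ω]⊆q) = functorial R G ω full clustered
  in q , q-part , λ x x∈s →
    let (v , _ , ωv≡x) = proj₂ image[ω]≡s x x∈s
    in subst (_∈ₛ q) ωv≡x (image[ω]⊆q v tt)

part⇒ΦEdgeSet : (c : ClusteringScheme) → Excisive c → (G : Hypergraph) {p : Subset (V G)} →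
  IsPart (c G) p → ΦEdgeSets (Clustered c) G p
part⇒ΦEdgeSet c excisive G {p} p-part =
  G ∣ p , excisive G p p-part , inclusion G p , inclusion-image G p

mainTheorem12 : (c : ClusteringScheme) → Functorial c → Excisive c →
    Σ (Hypergraph → Set₁) λ ℜ → Σ ℕ∞ λ k → Positive k × Refines (Representable ℜ k) c
mainTheorem12 c functorial excisive = Clustered c , ∞ , tt , λ G → coarser G , finer G
  where
  coarser : ∀ G p → IsPart (Representable (Clustered c) ∞ G) p →
            Σ (Subset (V G)) λ q → IsPart (c G) q × p ⊆ₛ q
  coarser G p p-part =
    let (s , Φ-edge , p⊆s) = ΠFam-∞-part⊆member p-part
        (q , q-part , s⊆q) = ΦEdgeSet⊆part c functorial G Φ-edge
    in q , q-part , ⊆ₛ-trans p⊆s s⊆q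

  finer : ∀ G p → IsPart (c G) p → IsPart (Representable (Clustered c) ∞ G) p
  finer G p p-part = ΠFam-∞-member⇒part (part⇒ΦEdgeSet c excisive G p-part)
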